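{- For a positive integer $n$, the graph $A(n)$ is a tree (i.e. its underlying undirected graph contains no cycle) if and only if there exists $(s,t)\in\mathbb{N}_0\times\mathbb{N}_0$ such that $$n = 2^{s+t+1} \pm 2^s - 1 > 0$$ for one of the two choices of sign.
   Context: A hyperbinary expansion of a positive integer $n$ is a word $x_1\cdots x_k$ over the alphabet $\{0,1,2\}$ with $x_1\neq 0$ and $n=\sum_{i=1}^k x_i2^{k-i}$; $\mathcal H(n)$ denotes the set of hyperbinary expansions of $n$. Words are regarded up to leading zeros. Single-step reductions are: (I) $2\vec y \to 1\,0\,\vec y$; (II) $\vec x\,0\,2\,\vec y\to \vec x\,1\,0\,\vec y$; (III) $\vec x\,1\,2\,\vec y \twoheadrightarrow \vec x\,2\,0\,\vec y$, for words $\vec x,\vec y$ over $\{0,1,2\}$ (type I is type II applied to $0\,2\,\vec y$). If $\vec u$ is transformed into $\vec v$ by one single-step reduction, $\vec v$ is a child of $\vec u$. $A(n)$ is the directed graph with vertex set $\mathcal H(n)$ and an arc from $\vec u$ to $\vec v$ iff $\vec v$ is a child of $\vec u$. $\mathbb{N}_0=\{0,1,2,\dots\}$. -}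

module Defs where

open import Data.Nat using (ℕ; zero; suc; _+_; _*_; _≤_)
open import Data.List using (List; []; _∷_; _++_; [_]; foldl; length)
open import Data.List.Relation.Unary.All using (All)
open import Data.List.Relation.Unary.Unique.Propositional using (Unique)
open import Data.Product using (Σ; _×_)
open import Data.Sum using (_⊎_)
open import Data.Unit using (⊤)
open import Relation.Binary.PropositionalEquality using (_≡_)
open import Relation.Nullary using (¬_)

data Digit : Set where
  d0 d1 d2 : Digit

digitVal : Digit → ℕ
digitVal d0 = 0
digitVal d1 = 1
digitVal d2 = 2

-- words x₁ ⋯ x_k over {0,1,2}, most significant digit first
Word : Set
Word = List Digit

-- value  Σ xᵢ 2^(k-i)  (Horner evaluation)
value : Word → ℕ
value = foldl (λ acc d → 2 * acc + digitVal d) 0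

-- w ∈ 𝓗(n): first digit nonzero and value n.  Words are taken in this
-- canonical form (no leading zeros), so "up to leading zeros" is built in.
IsHyp : ℕ → Word → Set
IsHyp n []      = 0 ≡ 1
IsHyp n (x ∷ w) = ¬ (x ≡ d0) × value (x ∷ w) ≡ n

-- single-step reductions: Child u v  means  v is a child of u
data Child : Word → Word → Set where
  typeI   : ∀ y   → Child (d2 ∷ y) (d1 ∷ d0 ∷ y)
  typeII  : ∀ x y → Child (x ++ d0 ∷ d2 ∷ y) (x ++ d1 ∷ d0 ∷ y)
  typeIII : ∀ x y → Child (x ++ d1 ∷ d2 ∷ y) (x ++ d2 ∷ d0 ∷ y)

Adj : ℕ → Word → Word → Set
Adj n u v = IsHyp n u × IsHyp n v × (Child u v ⊎ Child v u)

Path : ℕ → List Word → Set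
Path n []            = ⊤
Path n (u ∷ [])      = ⊤
Path n (u ∷ v ∷ vs)  = Adj n u v × Path n (v ∷ vs)

ClosedWalk : ℕ → List Word → Set
ClosedWalk n []       = ⊤
ClosedWalk n (v ∷ vs) = Path n (v ∷ vs ++ [ v ])

HasCycle : ℕ → Set
HasCycle n = Σ (List Word) λ vs →
  3 ≤ length vs × Unique vs × All (IsHyp n) vs × ClosedWalk n vs

IsTree : ℕ → Set
IsTree n = ¬ HasCycle n

-- The children of a word correspond to its maximal blocks of 2s, and every
-- reduction lowers the digit sum by one.  If no expansion of n has two blocks,
-- every vertex of A(n) has at most one child, and then a cycle is impossible:
-- along a non-backtracking closed walk, once a step goes against an arc every
-- later step must do so too, so the digit sum can never come back.  If some
-- expansion has two blocks, the two reductions commute and close a 4-cycle.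
-- Reading expansions from the last digit (those of 2m+1 end in 1, those of
-- 2m+2 in 0 or 2) shows that no expansion of n has two blocks exactly when n
-- is 2^(t+1) or 2^(t+1) - 2 followed by s binary ones, which is the stated form.
module Submission where

open import Defs
open import Data.Bool using (Bool; true; false)
open import Data.Empty using (⊥; ⊥-elim)
open import Data.List using (List; []; _∷_; _++_; [_]; _∷ʳ_; foldl; head)
open import Data.List.Properties using (foldl-++; foldl-∷ʳ; ++-assoc; ++-cancelˡ; ∷-injectiveˡ)
open import Data.List.Relation.Unary.All as All using (All; []; _∷_)
open import Data.List.Relation.Unary.AllPairs using ([]; _∷_)
open import Data.List.Relation.Unary.AllPairs.Properties using (++⁺)
open import Data.List.Relation.Unary.Unique.Propositional using (Unique)
open import Data.List.Reverse using (Reverse; reverseView; []; _∶_∶ʳ_)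
open import Data.Maybe.Relation.Unary.All as Maybe using (just; nothing)
open import Data.Nat using (ℕ; zero; suc; _+_; _*_; _^_; _≤_; _<_; z≤n; s≤s)
open import Data.Nat.Properties
open import Data.Nat.Tactic.RingSolver using (solve-∀)
open import Data.Product using (∃; _×_; _,_; proj₁; proj₂)
import Data.Product as Product
open import Data.Sum using (_⊎_; inj₁; inj₂)
import Data.Sum as Sum
open import Data.Unit using (⊤; tt)
open import Function using (_∘_)
open import Function.Bundles using (_⇔_; mk⇔)
open import Relation.Binary.PropositionalEquality
  using (_≡_; _≢_; refl; sym; trans; cong; cong₂; subst; subst₂; ≢-sym; module ≡-Reasoning)
open ≡-Reasoning

-- Value and digit sum

step : ℕ → Digit → ℕ
step acc d = 2 * acc + digitVal d

value-∷ʳ : ∀ u d → value (u ∷ʳ d) ≡ 2 * value u + digitVal d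
value-∷ʳ u d = foldl-∷ʳ step 0 d u

2*n+2≡2*[1+n] : ∀ v → 2 * v + 2 ≡ 2 * suc v
2*n+2≡2*[1+n] v = trans (+-comm (2 * v) 2) (sym (*-suc 2 v))

value-∷ʳ0 : ∀ u {m} → value u ≡ m → value (u ∷ʳ d0) ≡ 2 * m
value-∷ʳ0 u refl = trans (value-∷ʳ u d0) (+-identityʳ _)

value-∷ʳ1 : ∀ u {m} → value u ≡ m → value (u ∷ʳ d1) ≡ suc (2 * m)
value-∷ʳ1 u refl = trans (value-∷ʳ u d1) (+-comm _ 1)

value-∷ʳ2 : ∀ u {m} → value u ≡ m → value (u ∷ʳ d2) ≡ 2 * suc m
value-∷ʳ2 u refl = trans (value-∷ʳ u d2) (2*n+2≡2*[1+n] _)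

value-replace : ∀ x {v w} y → (∀ acc → foldl step acc v ≡ foldl step acc w) →
                value (x ++ v ++ y) ≡ value (x ++ w ++ y)
value-replace x {v} {w} y same = begin
  value (x ++ v ++ y)                   ≡⟨ foldl-++ step 0 x (v ++ y) ⟩
  foldl step (value x) (v ++ y)         ≡⟨ foldl-++ step (value x) v y ⟩
  foldl step (foldl step (value x) v) y ≡⟨ cong (λ acc → foldl step acc y) (same (value x)) ⟩
  foldl step (foldl step (value x) w) y ≡⟨ foldl-++ step (value x) w y ⟨
  foldl step (value x) (w ++ y)         ≡⟨ foldl-++ step 0 x (w ++ y) ⟨
  value (x ++ w ++ y)                   ∎

carry-0→1 : ∀ a → 2 * (2 * a + 0) + 2 ≡ 2 * (2 * a + 1) + 0
carry-0→1 = solve-∀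

carry-1→2 : ∀ a → 2 * (2 * a + 1) + 2 ≡ 2 * (2 * a + 2) + 0
carry-1→2 = solve-∀

value-child : ∀ {u v} → Child u v → value u ≡ value v
value-child (typeI y)     = refl
value-child (typeII x y)  = value-replace x y carry-0→1
value-child (typeIII x y) = value-replace x y carry-1→2

hyp-value : ∀ {n u} → IsHyp n u → value u ≡ n
hyp-value {u = _ ∷ _} (_ , val) = val

hyp-child : ∀ {n u v} → IsHyp n u → Child u v → IsHyp n v
hyp-child (_ , val)    (typeI y)              = (λ ()) , val
hyp-child (lead , _)   (typeII [] y)          = ⊥-elim (lead refl)
hyp-child (lead , val) c@(typeII (_ ∷ _) y)   = lead , trans (sym (value-child c)) val
hyp-child (_ , val)    c@(typeIII [] y)       = (λ ()) , trans (sym (value-child c)) val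
hyp-child (lead , val) c@(typeIII (_ ∷ _) y)  = lead , trans (sym (value-child c)) val

-- Rules II and III together: a 2 preceded by a becomes 0, and a becomes a + 1.
data DigitSuc : Digit → Digit → Set where
  0→1 : DigitSuc d0 d1
  1→2 : DigitSuc d1 d2

child-carry : ∀ {a a'} → DigitSuc a a' → ∀ x y → Child (x ++ a ∷ d2 ∷ y) (x ++ a' ∷ d0 ∷ y)
child-carry 0→1 = typeII
child-carry 1→2 = typeIII

child-carry-inner : ∀ {a a'} → DigitSuc a a' → ∀ x z y →
                    Child (x ++ z ++ a ∷ d2 ∷ y) (x ++ z ++ a' ∷ d0 ∷ y)
child-carry-inner c x z y =
  subst₂ Child (++-assoc x z _) (++-assoc x z _) (child-carry c (x ++ z) y)

carry-≢ : ∀ {a a'} → DigitSuc a a' → a' ≢ a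
carry-≢ 0→1 ()
carry-≢ 1→2 ()

digitSum : Word → ℕ
digitSum []      = 0
digitSum (d ∷ w) = digitVal d + digitSum w

digitSum-++ : ∀ x y → digitSum (x ++ y) ≡ digitSum x + digitSum y
digitSum-++ []      y = refl
digitSum-++ (d ∷ x) y = trans (cong (digitVal d +_) (digitSum-++ x y)) (sym (+-assoc (digitVal d) _ _))

digitSum-carry : ∀ {a a'} → DigitSuc a a' → ∀ x y →
                 digitSum (x ++ a' ∷ d0 ∷ y) < digitSum (x ++ a ∷ d2 ∷ y)
digitSum-carry c x y = subst₂ _<_ (sym (digitSum-++ x _)) (sym (digitSum-++ x _))
                                  (+-monoʳ-< (digitSum x) (lt c))
  where
  lt : ∀ {a a'} → DigitSuc a a' → digitVal a' + digitSum y < digitVal a + (2 + digitSum y)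
  lt 0→1 = ≤-refl
  lt 1→2 = ≤-refl

digitSum-child : ∀ {u v} → Child u v → digitSum v < digitSum u
digitSum-child (typeI y)     = ≤-refl
digitSum-child (typeII x y)  = digitSum-carry 0→1 x y
digitSum-child (typeIII x y) = digitSum-carry 1→2 x y

-- Blocks of 2s and children

-- runsFrom r w counts the maximal blocks of 2s of w, except a leading block
-- when r says that w continues a block already open.
runsFrom : Bool → Word → ℕ
runsFrom _     []       = 0
runsFrom _     (d0 ∷ w) = runsFrom false w
runsFrom _     (d1 ∷ w) = runsFrom false w
runsFrom false (d2 ∷ w) = suc (runsFrom true w)
runsFrom true  (d2 ∷ w) = runsFrom true w

runs : Word → ℕ
runs = runsFrom false

endsInRun : Bool → Word → Bool
endsInRun r []       = r
endsInRun _ (d0 ∷ w) = endsInRun false w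
endsInRun _ (d1 ∷ w) = endsInRun false w
endsInRun _ (d2 ∷ w) = endsInRun true w

runsFrom-++ : ∀ r u v → runsFrom r (u ++ v) ≡ runsFrom r u + runsFrom (endsInRun r u) v
runsFrom-++ r     []       v = refl
runsFrom-++ _     (d0 ∷ u) v = runsFrom-++ false u v
runsFrom-++ _     (d1 ∷ u) v = runsFrom-++ false u v
runsFrom-++ false (d2 ∷ u) v = cong suc (runsFrom-++ true u v)
runsFrom-++ true  (d2 ∷ u) v = runsFrom-++ true u v

data NonTwo : Digit → Set where
  nonTwo0 : NonTwo d0
  nonTwo1 : NonTwo d1

runs-∷ʳ-nonTwo : ∀ u {d} → NonTwo d → runs (u ∷ʳ d) ≡ runs u
runs-∷ʳ-nonTwo u nonTwo0 = trans (runsFrom-++ false u [ d0 ]) (+-identityʳ _)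
runs-∷ʳ-nonTwo u nonTwo1 = trans (runsFrom-++ false u [ d1 ]) (+-identityʳ _)

runs-∷ʳ-carry : ∀ u {a} → NonTwo a → runs (u ∷ʳ a ∷ʳ d2) ≡ runs u + 1
runs-∷ʳ-carry u {a} na =
  trans (cong runs (++-assoc u [ a ] [ d2 ])) (trans (runsFrom-++ false u _) (last na))
  where
  last : NonTwo a → runs u + runsFrom (endsInRun false u) (a ∷ d2 ∷ []) ≡ runs u + 1
  last nonTwo0 = refl
  last nonTwo1 = refl

1<runs-∷ʳ-carry : ∀ u {a} → NonTwo a → 0 < runs u → 1 < runs (u ∷ʳ a ∷ʳ d2)
1<runs-∷ʳ-carry u na r = ≤-trans (+-monoˡ-≤ 1 r) (≤-reflexive (sym (runs-∷ʳ-carry u na)))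

runs-∷ʳ-22 : ∀ u → runs (u ∷ʳ d2 ∷ʳ d2) ≡ runs (u ∷ʳ d2)
runs-∷ʳ-22 u = begin
  runs (u ∷ʳ d2 ∷ʳ d2)                     ≡⟨ cong runs (++-assoc u [ d2 ] [ d2 ]) ⟩
  runs (u ++ d2 ∷ d2 ∷ [])                 ≡⟨ runsFrom-++ false u _ ⟩
  runs u + runsFrom r (d2 ∷ d2 ∷ [])       ≡⟨ cong (runs u +_) (merge r) ⟩
  runs u + runsFrom r [ d2 ]               ≡⟨ runsFrom-++ false u [ d2 ] ⟨
  runs (u ∷ʳ d2)                           ∎
  where
  r = endsInRun false u
  merge : ∀ r → runsFrom r (d2 ∷ d2 ∷ []) ≡ runsFrom r [ d2 ]
  merge false = refl
  merge true  = refl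

runs-∷ʳ-≤ : ∀ u d → runs (u ∷ʳ d) ≤ suc (runs u)
runs-∷ʳ-≤ u d = ≤-trans (≤-reflexive (runsFrom-++ false u [ d ]))
                (≤-trans (+-monoʳ-≤ (runs u) (single (endsInRun false u) d))
                         (≤-reflexive (+-comm (runs u) 1)))
  where
  single : ∀ r d → runsFrom r [ d ] ≤ 1
  single _     d0 = z≤n
  single _     d1 = z≤n
  single false d2 = ≤-refl
  single true  d2 = z≤n

0<runs-++-2 : ∀ x y → 0 < runs (x ++ d2 ∷ y)
0<runs-++-2 []       y = s≤s z≤n
0<runs-++-2 (d0 ∷ x) y = 0<runs-++-2 x y
0<runs-++-2 (d1 ∷ x) y = 0<runs-++-2 x y
0<runs-++-2 (d2 ∷ x) y = s≤s z≤n

0<runsFrom-carry : ∀ {a a'} → DigitSuc a a' → ∀ r x y → 0 < runsFrom r (x ++ a ∷ d2 ∷ y)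
0<runsFrom-carry 0→1 _     []       y = s≤s z≤n
0<runsFrom-carry 1→2 _     []       y = s≤s z≤n
0<runsFrom-carry c   _     (d0 ∷ x) y = 0<runsFrom-carry c false x y
0<runsFrom-carry c   _     (d1 ∷ x) y = 0<runsFrom-carry c false x y
0<runsFrom-carry c   false (d2 ∷ x) y = s≤s z≤n
0<runsFrom-carry c   true  (d2 ∷ x) y = 0<runsFrom-carry c true x y

prefix-nonTwo : ∀ {a a'} → DigitSuc a a' → ∀ x y → runs (x ++ a ∷ d2 ∷ y) ≤ 1 → All NonTwo x
prefix-nonTwo c []       y _       = []
prefix-nonTwo c (d0 ∷ x) y h       = nonTwo0 ∷ prefix-nonTwo c x y h
prefix-nonTwo c (d1 ∷ x) y h       = nonTwo1 ∷ prefix-nonTwo c x y h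
prefix-nonTwo c (d2 ∷ x) y (s≤s h) = ⊥-elim (≤⇒≯ h (0<runsFrom-carry c true x y))

firstChild : Word → Word
firstChild (d2 ∷ y)      = d1 ∷ d0 ∷ y
firstChild (d0 ∷ d2 ∷ y) = d1 ∷ d0 ∷ y
firstChild (d1 ∷ d2 ∷ y) = d2 ∷ d0 ∷ y
firstChild (a ∷ y)       = a ∷ firstChild y
firstChild []            = []

firstChild-∷ : ∀ {c} w → NonTwo c → Maybe.All NonTwo (head w) → firstChild (c ∷ w) ≡ c ∷ firstChild w
firstChild-∷ []      nonTwo0 nothing         = refl
firstChild-∷ []      nonTwo1 nothing         = refl
firstChild-∷ (_ ∷ _) nonTwo0 (just nonTwo0)  = refl
firstChild-∷ (_ ∷ _) nonTwo0 (just nonTwo1)  = refl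
firstChild-∷ (_ ∷ _) nonTwo1 (just nonTwo0)  = refl
firstChild-∷ (_ ∷ _) nonTwo1 (just nonTwo1)  = refl

firstChild-carry : ∀ {a a'} → DigitSuc a a' → ∀ x y → All NonTwo x →
                   firstChild (x ++ a ∷ d2 ∷ y) ≡ x ++ a' ∷ d0 ∷ y
firstChild-carry 0→1 []      y []       = refl
firstChild-carry 1→2 []      y []       = refl
firstChild-carry c   (b ∷ x) y (nb ∷ nx) =
  trans (firstChild-∷ _ nb (head-nonTwo c x nx)) (cong (b ∷_) (firstChild-carry c x y nx))
  where
  head-nonTwo : ∀ {a a'} → DigitSuc a a' → ∀ x → All NonTwo x → Maybe.All NonTwo (head (x ++ a ∷ d2 ∷ y))
  head-nonTwo 0→1 []      []      = just nonTwo0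
  head-nonTwo 1→2 []      []      = just nonTwo1
  head-nonTwo _   (_ ∷ _) (n ∷ _) = just n

child≡firstChild : ∀ {u v} → runs u ≤ 1 → Child u v → v ≡ firstChild u
child≡firstChild _ (typeI y)     = refl
child≡firstChild h (typeII x y)  = sym (firstChild-carry 0→1 x y (prefix-nonTwo 0→1 x y h))
child≡firstChild h (typeIII x y) = sym (firstChild-carry 1→2 x y (prefix-nonTwo 1→2 x y h))

-- Acyclicity

AtMostOneChild : ℕ → Set
AtMostOneChild n = ∀ {u v v'} → IsHyp n u → Child u v → Child u v' → v ≡ v'

lastOf : Word → List Word → Word
lastOf y []      = y
lastOf _ (z ∷ l) = lastOf z l

penultimateOf : Word → Word → List Word → Word
penultimateOf x _ []      = x
penultimateOf _ y (z ∷ l) = penultimateOf y z l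

lastOf-∷ʳ : ∀ y l z → lastOf y (l ∷ʳ z) ≡ z
lastOf-∷ʳ y []      z = refl
lastOf-∷ʳ _ (a ∷ l) z = lastOf-∷ʳ a l z

penultimateOf-∷ʳ : ∀ x y l z → penultimateOf x y (l ∷ʳ z) ≡ lastOf y l
penultimateOf-∷ʳ x y []      z = refl
penultimateOf-∷ʳ _ y (a ∷ l) z = penultimateOf-∷ʳ y a l z

All-lastOf : ∀ {P : Word → Set} y l → All P (y ∷ l) → P (lastOf y l)
All-lastOf y []      (p ∷ _)  = p
All-lastOf _ (a ∷ l) (_ ∷ ps) = All-lastOf a l ps

NonBacktracking : List Word → Set
NonBacktracking (x ∷ y ∷ z ∷ l) = x ≢ z × NonBacktracking (y ∷ z ∷ l)
NonBacktracking _               = ⊤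

unique⇒nonBacktracking : ∀ xs → Unique xs → NonBacktracking xs
unique⇒nonBacktracking (x ∷ y ∷ z ∷ l) ((_ ∷ x≢z ∷ _) ∷ d) = x≢z , unique⇒nonBacktracking (y ∷ z ∷ l) d
unique⇒nonBacktracking []              _                    = tt
unique⇒nonBacktracking (_ ∷ [])        _                    = tt
unique⇒nonBacktracking (_ ∷ _ ∷ [])    _                    = tt

module _ {n : ℕ} (oneChild : AtMostOneChild n) where

  -- With at most one child per vertex, a non-backtracking walk that once steps
  -- against an arc must keep doing so.
  keeps-ascending : ∀ l {x y} → Path n (x ∷ y ∷ l) → NonBacktracking (x ∷ y ∷ l) → Child y x →
                    digitSum x < digitSum (lastOf y l) × Child (lastOf y l) (penultimateOf x y l)
  keeps-ascending []      _                                    _         y→x = digitSum-child y→x , y→x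
  keeps-ascending (z ∷ l) (_ , ((hy , _ , inj₁ y→z) , _))      (x≢z , _) y→x =
    ⊥-elim (x≢z (oneChild hy y→x y→z))
  keeps-ascending (z ∷ l) (_ , walk@((_ , _ , inj₂ z→y) , _)) (_ , nb)  y→x =
    Product.map₁ (<-trans (digitSum-child y→x)) (keeps-ascending l walk nb z→y)

  descends-or-turns : ∀ l {x y} → Path n (x ∷ y ∷ l) → NonBacktracking (x ∷ y ∷ l) → Child x y →
                      digitSum (lastOf y l) < digitSum x ⊎ Child (lastOf y l) (penultimateOf x y l)
  descends-or-turns []      _                                    _        x→y = inj₁ (digitSum-child x→y)
  descends-or-turns (z ∷ l) (_ , walk@((_ , _ , inj₂ z→y) , _)) (_ , nb) _   =
    inj₂ (proj₂ (keeps-ascending l walk nb z→y))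
  descends-or-turns (z ∷ l) (_ , walk@((_ , _ , inj₁ y→z) , _)) (_ , nb) x→y =
    Sum.map₁ (λ lt → <-trans lt (digitSum-child x→y)) (descends-or-turns l walk nb y→z)

  no-closed-walk : ∀ v w₁ w₂ rest → Path n (v ∷ w₁ ∷ w₂ ∷ rest ∷ʳ v) →
                   NonBacktracking (v ∷ w₁ ∷ w₂ ∷ rest ∷ʳ v) → w₁ ≢ lastOf w₂ rest → ⊥
  no-closed-walk v w₁ w₂ rest walk@((_ , _ , inj₂ w₁→v) , _) nb _ =
    <-irrefl (sym (cong digitSum (lastOf-∷ʳ w₁ (w₂ ∷ rest) v)))
             (proj₁ (keeps-ascending (w₂ ∷ rest ∷ʳ v) walk nb w₁→v))
  no-closed-walk v w₁ w₂ rest walk@((hv , _ , inj₁ v→w₁) , _) nb w₁≢last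
    with descends-or-turns (w₂ ∷ rest ∷ʳ v) walk nb v→w₁
  ... | inj₁ lt   = <-irrefl (cong digitSum (lastOf-∷ʳ w₁ (w₂ ∷ rest) v)) lt
  ... | inj₂ turn = w₁≢last (oneChild hv v→w₁
                      (subst₂ Child (lastOf-∷ʳ w₁ (w₂ ∷ rest) v)
                                    (penultimateOf-∷ʳ v w₁ (w₂ ∷ rest) v) turn))

  acyclic : IsTree n
  acyclic ([]                  , ()                , _)
  acyclic (_ ∷ []              , s≤s ()            , _)
  acyclic (_ ∷ _ ∷ []          , s≤s (s≤s ())      , _)
  acyclic (v ∷ w₁ ∷ w₂ ∷ rest , _ , v≢@(_ ∷ v≢w₂ ∷ _) ∷ distinct@(w₁≢ ∷ _) , _ , walk) =
    no-closed-walk v w₁ w₂ rest walk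
      (v≢w₂ , unique⇒nonBacktracking (w₁ ∷ w₂ ∷ rest ∷ʳ v) distinct-∷ʳ)
      (All-lastOf w₂ rest w₁≢)
    where
    distinct-∷ʳ : Unique (w₁ ∷ w₂ ∷ rest ∷ʳ v)
    distinct-∷ʳ = ++⁺ distinct ([] ∷ []) (All.map (λ ne → ≢-sym ne ∷ []) v≢)

-- Cycles

diamond-cycle : ∀ {n u v v' w} → IsHyp n u → Child u v → Child u v' → Child v w → Child v' w →
                v ≢ v' → HasCycle n
diamond-cycle {u = u} {v} {v'} {w} hu u→v u→v' v→w v'→w v≢v' =
  u ∷ v ∷ w ∷ v' ∷ [] , s≤s (s≤s (s≤s z≤n)) ,
  (above u→v ∷ above2 ∷ above u→v' ∷ []) ∷ (above v→w ∷ v≢v' ∷ []) ∷ (≢-sym (above v'→w) ∷ []) ∷ [] ∷ [] ,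
  hu ∷ hv ∷ hw ∷ hv' ∷ [] ,
  (hu , hv , inj₁ u→v) , (hv , hw , inj₁ v→w) , (hw , hv' , inj₂ v'→w) , (hv' , hu , inj₂ u→v') , tt
  where
  hv  = hyp-child hu u→v
  hw  = hyp-child hv v→w
  hv' = hyp-child hu u→v'
  above : ∀ {a b} → Child a b → a ≢ b
  above a→b = >⇒≢ (digitSum-child a→b) ∘ cong digitSum
  above2 : u ≢ w
  above2 = >⇒≢ (<-trans (digitSum-child v→w) (digitSum-child u→v)) ∘ cong digitSum

twoCarries-cycle : ∀ {n a a' b b'} → DigitSuc a a' → DigitSuc b b' → ∀ x z y →
                   IsHyp n (x ++ a ∷ d2 ∷ z ++ b ∷ d2 ∷ y) → HasCycle n
twoCarries-cycle {a = a} {a'} {b} {b'} ca cb x z y hu =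
  diamond-cycle hu (child-carry ca x (z ++ b ∷ d2 ∷ y)) (child-carry-inner cb x (a ∷ d2 ∷ z) y)
                   (child-carry-inner cb x (a' ∷ d0 ∷ z) y) (child-carry ca x (z ++ b' ∷ d0 ∷ y))
                   (carry-≢ ca ∘ ∷-injectiveˡ ∘ ++-cancelˡ x _ _)

leadingTwoAndCarry-cycle : ∀ {n a a'} → DigitSuc a a' → ∀ x y → IsHyp n (d2 ∷ x ++ a ∷ d2 ∷ y) → HasCycle n
leadingTwoAndCarry-cycle {a = a} {a'} c x y hu =
  diamond-cycle hu (typeI (x ++ a ∷ d2 ∷ y)) (child-carry c (d2 ∷ x) y)
                   (child-carry c (d1 ∷ d0 ∷ x) y) (typeI (x ++ a' ∷ d0 ∷ y)) (λ ())

isTwo : Digit → Bool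
isTwo d2 = true
isTwo _  = false

record CarrySplit (k : ℕ) (w : Word) : Set where
  constructor carrySplit
  field
    prefix : Word
    carried carried' : Digit
    suffix : Word
    carry : DigitSuc carried carried'
    split : w ≡ prefix ++ carried ∷ d2 ∷ suffix
    runsAfter : k ≤ runsFrom true suffix

carrySplit-∷ : ∀ {k w} c → CarrySplit k w → CarrySplit k (c ∷ w)
carrySplit-∷ c (carrySplit x a a' y r eq h) = carrySplit (c ∷ x) a a' y r (cong (c ∷_) eq) h

-- The first block of 2s inside w is preceded by a digit of c ∷ w, and can carry into it.
firstCarry : ∀ {k} c w → suc k ≤ runsFrom (isTwo c) w → CarrySplit k (c ∷ w)
firstCarry c  (d0 ∷ w) h       = carrySplit-∷ c (firstCarry d0 w h)
firstCarry c  (d1 ∷ w) h       = carrySplit-∷ c (firstCarry d1 w h)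
firstCarry d2 (d2 ∷ w) h       = carrySplit-∷ d2 (firstCarry d2 w h)
firstCarry d0 (d2 ∷ w) (s≤s h) = carrySplit [] d0 d1 w 0→1 refl h
firstCarry d1 (d2 ∷ w) (s≤s h) = carrySplit [] d1 d2 w 1→2 refl h

branching⇒cycle : ∀ {n} u → value u ≡ n → 1 < runs u → HasCycle n
branching⇒cycle (d0 ∷ w) val h = branching⇒cycle w val h
branching⇒cycle (d1 ∷ w) val h with firstCarry d1 w h
... | carrySplit x _ _ y ca eq k with firstCarry d2 y k
...   | carrySplit []      _ _ _ 0→1 () _
...   | carrySplit []      _ _ _ 1→2 () _
...   | carrySplit (_ ∷ z) _ _ y' cb refl _ =
        twoCarries-cycle ca cb x z y' (subst (IsHyp _) eq ((λ ()) , val))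
branching⇒cycle (d2 ∷ w) val (s≤s h) with firstCarry d2 w h
... | carrySplit []      _ _ _ 0→1 () _
... | carrySplit []      _ _ _ 1→2 () _
... | carrySplit (_ ∷ x) _ _ y c refl _ = leadingTwoAndCarry-cycle c x y ((λ ()) , val)

-- Numbers whose expansions have at most one block

lastDigit-zero : ∀ v d → 2 * v + digitVal d ≡ 0 → d ≡ d0 × v ≡ 0
lastDigit-zero zero    d0 _ = refl , refl
lastDigit-zero zero    d1 ()
lastDigit-zero zero    d2 ()
lastDigit-zero (suc v) _  ()

lastDigit-odd : ∀ v d {m} → 2 * v + digitVal d ≡ suc (2 * m) → d ≡ d1 × v ≡ m
lastDigit-odd v d0 {m} eq = ⊥-elim (even≢odd v m (trans (sym (+-identityʳ _)) eq))
lastDigit-odd v d1 {m} eq = refl , *-cancelˡ-≡ v m 2 (suc-injective (trans (+-comm 1 (2 * v)) eq))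
lastDigit-odd v d2 {m} eq = ⊥-elim (even≢odd (suc v) m (trans (sym (2*n+2≡2*[1+n] v)) eq))

lastDigit-even : ∀ v d {m} → 2 * v + digitVal d ≡ 2 * suc m → (d ≡ d0 × v ≡ suc m) ⊎ (d ≡ d2 × v ≡ m)
lastDigit-even v d0 {m} eq = inj₁ (refl , *-cancelˡ-≡ v (suc m) 2 (trans (sym (+-identityʳ _)) eq))
lastDigit-even v d1 {m} eq = ⊥-elim (even≢odd (suc m) v (sym (trans (+-comm 1 (2 * v)) eq)))
lastDigit-even v d2 {m} eq =
  inj₂ (refl , suc-injective (*-cancelˡ-≡ (suc v) (suc m) 2 (trans (sym (2*n+2≡2*[1+n] v)) eq)))

expansion-odd : ∀ w {m} → value w ≡ suc (2 * m) → ∃ λ u → w ≡ u ∷ʳ d1 × value u ≡ m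
expansion-odd w eq with reverseView w
expansion-odd _ () | []
expansion-odd _ {m} eq | u ∶ _ ∶ʳ d with lastDigit-odd (value u) d {m} (trans (sym (value-∷ʳ u d)) eq)
... | refl , val = u , refl , val

expansion-even : ∀ w {m} → value w ≡ 2 * suc m →
                 ∃ λ u → (w ≡ u ∷ʳ d0 × value u ≡ suc m) ⊎ (w ≡ u ∷ʳ d2 × value u ≡ m)
expansion-even w eq with reverseView w
expansion-even _ () | []
expansion-even _ {m} eq | u ∶ _ ∶ʳ d with lastDigit-even (value u) d {m} (trans (sym (value-∷ʳ u d)) eq)
... | inj₁ (refl , val) = u , inj₁ (refl , val)
... | inj₂ (refl , val) = u , inj₂ (refl , val)

TwoFree : ℕ → Set
TwoFree n = ∀ u → value u ≡ n → runs u ≡ 0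

Unbranched : ℕ → Set
Unbranched n = ∀ u → value u ≡ n → runs u ≤ 1

UnbranchedThen2 : ℕ → Set
UnbranchedThen2 n = ∀ u → value u ≡ n → runs (u ∷ʳ d2) ≤ 1

twoFree-zero : TwoFree 0
twoFree-zero w = go (reverseView w)
  where
  go : ∀ {w} → Reverse w → value w ≡ 0 → runs w ≡ 0
  go [] _ = refl
  go (u ∶ ru ∶ʳ d) eq with lastDigit-zero (value u) d (trans (sym (value-∷ʳ u d)) eq)
  ... | refl , val = trans (runs-∷ʳ-nonTwo u nonTwo0) (go ru val)

twoFree-odd : ∀ {m} → TwoFree m → TwoFree (suc (2 * m))
twoFree-odd h w eq with expansion-odd w eq
... | u , refl , val = trans (runs-∷ʳ-nonTwo u nonTwo1) (h u val)

twoFree⇒unbranched : ∀ {n} → TwoFree n → Unbranched n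
twoFree⇒unbranched h u eq = ≤-trans (≤-reflexive (h u eq)) z≤n

twoFree⇒unbranchedThen2 : ∀ {n} → TwoFree n → UnbranchedThen2 n
twoFree⇒unbranchedThen2 h u eq = ≤-trans (runs-∷ʳ-≤ u d2) (s≤s (≤-reflexive (h u eq)))

unbranched-odd : ∀ {m} → Unbranched m → Unbranched (suc (2 * m))
unbranched-odd h w eq with expansion-odd w eq
... | u , refl , val = ≤-trans (≤-reflexive (runs-∷ʳ-nonTwo u nonTwo1)) (h u val)

unbranched-even : ∀ {m} → Unbranched (suc m) → UnbranchedThen2 m → Unbranched (2 * suc m)
unbranched-even h h2 w eq with expansion-even w eq
... | u , inj₁ (refl , val) = ≤-trans (≤-reflexive (runs-∷ʳ-nonTwo u nonTwo0)) (h u val)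
... | u , inj₂ (refl , val) = h2 u val

unbranchedThen2-even : ∀ {m} → TwoFree (suc m) → UnbranchedThen2 m → UnbranchedThen2 (2 * suc m)
unbranchedThen2-even h h2 w eq with expansion-even w eq
... | u , inj₁ (refl , val) = ≤-reflexive (trans (runs-∷ʳ-carry u nonTwo0) (cong (_+ 1) (h u val)))
... | u , inj₂ (refl , val) = ≤-trans (≤-reflexive (runs-∷ʳ-22 u)) (h2 u val)

unbranched⇒atMostOneChild : ∀ {n} → Unbranched n → AtMostOneChild n
unbranched⇒atMostOneChild h {u} hu c c' = trans (child≡firstChild r c) (sym (child≡firstChild r c'))
  where r = h u (hyp-value hu)

appendOnes : ℕ → ℕ → ℕ
appendOnes zero    m = m
appendOnes (suc s) m = suc (2 * appendOnes s m)

mersenne : ℕ → ℕ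
mersenne i = appendOnes i 0

2^≡suc-mersenne : ∀ t → 2 ^ t ≡ suc (mersenne t)
2^≡suc-mersenne zero    = refl
2^≡suc-mersenne (suc t) = trans (cong (2 *_) (2^≡suc-mersenne t)) (*-suc 2 (mersenne t))

data TreeNumber : ℕ → Set where
  power         : ∀ s t → TreeNumber (appendOnes s (2 ^ suc t))
  powerMinusTwo : ∀ s t → TreeNumber (appendOnes s (2 * mersenne t))

twoFree-mersenne : ∀ i → TwoFree (mersenne i)
twoFree-mersenne zero    = twoFree-zero
twoFree-mersenne (suc i) = twoFree-odd (twoFree-mersenne i)

unbranched-appendOnes : ∀ s {m} → Unbranched m → Unbranched (appendOnes s m)
unbranched-appendOnes zero    h = h
unbranched-appendOnes (suc s) h = unbranched-odd (unbranched-appendOnes s h)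

unbranched-2^ : ∀ t → Unbranched (2 ^ t)
unbranched-2^ zero    = unbranched-odd (twoFree⇒unbranched twoFree-zero)
unbranched-2^ (suc t) = subst (Unbranched ∘ (2 *_)) (sym (2^≡suc-mersenne t))
  (unbranched-even (subst Unbranched (2^≡suc-mersenne t) (unbranched-2^ t))
                   (twoFree⇒unbranchedThen2 (twoFree-mersenne t)))

unbranchedThen2-2*mersenne : ∀ i → UnbranchedThen2 (2 * mersenne i)
unbranchedThen2-2*mersenne zero    = twoFree⇒unbranchedThen2 twoFree-zero
unbranchedThen2-2*mersenne (suc i) =
  unbranchedThen2-even (twoFree-mersenne (suc i)) (unbranchedThen2-2*mersenne i)

unbranched-2*mersenne : ∀ i → Unbranched (2 * mersenne i)
unbranched-2*mersenne zero    = twoFree⇒unbranched twoFree-zero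
unbranched-2*mersenne (suc i) =
  unbranched-even (twoFree⇒unbranched (twoFree-mersenne (suc i))) (unbranchedThen2-2*mersenne i)

treeNumber⇒unbranched : ∀ {n} → TreeNumber n → Unbranched n
treeNumber⇒unbranched (power s t)         = unbranched-appendOnes s (unbranched-2^ (suc t))
treeNumber⇒unbranched (powerMinusTwo s t) = unbranched-appendOnes s (unbranched-2*mersenne t)

appendOnes-+1 : ∀ s m → appendOnes s m + 1 ≡ 2 ^ s * (m + 1)
appendOnes-+1 zero    m = sym (+-identityʳ (m + 1))
appendOnes-+1 (suc s) m = begin
  suc (2 * appendOnes s m) + 1 ≡⟨ doubling (appendOnes s m) ⟩
  2 * (appendOnes s m + 1)     ≡⟨ cong (2 *_) (appendOnes-+1 s m) ⟩
  2 * (2 ^ s * (m + 1))        ≡⟨ *-assoc 2 (2 ^ s) (m + 1) ⟨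
  2 ^ suc s * (m + 1)          ∎
  where
  doubling : ∀ a → suc (2 * a) + 1 ≡ 2 * (a + 1)
  doubling = solve-∀

2^-split : ∀ s t → 2 ^ (s + t + 1) ≡ 2 ^ s * 2 ^ suc t
2^-split s t =
  trans (cong (2 ^_) (trans (+-assoc s t 1) (cong (s +_) (+-comm t 1)))) (^-distribˡ-+-* 2 s (suc t))

power-form : ∀ s t → appendOnes s (2 ^ suc t) + 1 ≡ 2 ^ (s + t + 1) + 2 ^ s
power-form s t = begin
  appendOnes s (2 ^ suc t) + 1   ≡⟨ appendOnes-+1 s _ ⟩
  2 ^ s * (2 ^ suc t + 1)        ≡⟨ *-distribˡ-+ (2 ^ s) (2 ^ suc t) 1 ⟩
  2 ^ s * 2 ^ suc t + 2 ^ s * 1  ≡⟨ cong₂ _+_ (sym (2^-split s t)) (*-identityʳ (2 ^ s)) ⟩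
  2 ^ (s + t + 1) + 2 ^ s        ∎

powerMinusTwo-form : ∀ s t → appendOnes s (2 * mersenne t) + 2 ^ s + 1 ≡ 2 ^ (s + t + 1)
powerMinusTwo-form s t = begin
  appendOnes s k + 2 ^ s + 1     ≡⟨ swap (appendOnes s k) (2 ^ s) ⟩
  appendOnes s k + 1 + 2 ^ s     ≡⟨ cong (_+ 2 ^ s) (appendOnes-+1 s k) ⟩
  2 ^ s * (k + 1) + 2 ^ s        ≡⟨ absorb (2 ^ s) (mersenne t) ⟩
  2 ^ s * (2 * mersenne t + 2)   ≡⟨ cong (λ x → 2 ^ s * x) (2*n+2≡2*[1+n] (mersenne t)) ⟩
  2 ^ s * (2 * suc (mersenne t)) ≡⟨ cong (λ x → 2 ^ s * (2 * x)) (2^≡suc-mersenne t) ⟨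
  2 ^ s * 2 ^ suc t              ≡⟨ 2^-split s t ⟨
  2 ^ (s + t + 1)                ∎
  where
  k = 2 * mersenne t
  swap : ∀ a p → a + p + 1 ≡ a + 1 + p
  swap = solve-∀
  absorb : ∀ p e → p * (2 * e + 1) + p ≡ p * (2 * e + 2)
  absorb = solve-∀

HasTreeForm : ℕ → Set
HasTreeForm n = ∃ λ s → ∃ λ t → (n + 1 ≡ 2 ^ (s + t + 1) + 2 ^ s) ⊎ (n + 2 ^ s + 1 ≡ 2 ^ (s + t + 1))

treeNumber⇒form : ∀ {n} → TreeNumber n → HasTreeForm n
treeNumber⇒form (power s t)         = s , t , inj₁ (power-form s t)
treeNumber⇒form (powerMinusTwo s t) = s , t , inj₂ (powerMinusTwo-form s t)

form⇒treeNumber : ∀ {n} → HasTreeForm n → TreeNumber n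
form⇒treeNumber {n} (s , t , inj₁ eq) =
  subst TreeNumber (+-cancelʳ-≡ 1 _ n (trans (power-form s t) (sym eq))) (power s t)
form⇒treeNumber {n} (s , t , inj₂ eq) =
  subst TreeNumber (+-cancelʳ-≡ (2 ^ s) _ n (+-cancelʳ-≡ 1 _ _ (trans (powerMinusTwo-form s t) (sym eq))))
        (powerMinusTwo s t)

-- Numbers with a branching expansion

data Binary : ℕ → Set where
  0ᵇ     : Binary 0
  1+[2_] : ∀ {m} → Binary m → Binary (suc (2 * m))
  2[1+_] : ∀ {m} → Binary (suc m) → Binary (2 * suc m)

binary-suc : ∀ {n} → Binary n → Binary (suc n)
binary-suc 0ᵇ         = 1+[2 0ᵇ ]
binary-suc 1+[2 b ]   = subst Binary (*-suc 2 _) 2[1+ binary-suc b ]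
binary-suc 2[1+ b ]   = 1+[2 b ]

binary : ∀ n → Binary n
binary zero    = 0ᵇ
binary (suc n) = binary-suc (binary n)

expansion : ∀ {m} → Binary m → ∃ λ u → value u ≡ m
expansion 0ᵇ       = [] , refl
expansion 1+[2 b ] = Product.map (_∷ʳ d1) (λ {u} → value-∷ʳ1 u) (expansion b)
expansion 2[1+ b ] = Product.map (_∷ʳ d0) (λ {u} → value-∷ʳ0 u) (expansion b)

IsMersenne : ℕ → Set
IsMersenne n = ∃ λ i → n ≡ mersenne i

HasTwo : ℕ → Set
HasTwo n = ∃ λ u → value u ≡ n × 0 < runs u

Branching : ℕ → Set
Branching n = ∃ λ u → value u ≡ n × 1 < runs u

BranchingThen2 : ℕ → Set
BranchingThen2 n = ∃ λ u → value u ≡ n × 1 < runs (u ∷ʳ d2)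

mersenne⊎hasTwo : ∀ {n} → Binary n → IsMersenne n ⊎ HasTwo n
mersenne⊎hasTwo 0ᵇ = inj₁ (0 , refl)
mersenne⊎hasTwo 1+[2 b ] with mersenne⊎hasTwo b
... | inj₁ (i , refl)    = inj₁ (suc i , refl)
... | inj₂ (u , val , r) =
  inj₂ (u ∷ʳ d1 , value-∷ʳ1 u val , subst (_ <_) (sym (runs-∷ʳ-nonTwo u nonTwo1)) r)
mersenne⊎hasTwo (2[1+_] {m} _) =
  let (u , val) = expansion (binary m) in inj₂ (u ∷ʳ d2 , value-∷ʳ2 u val , 0<runs-++-2 u [])

mersenne⊎2*mersenne⊎branchingThen2 : ∀ {n} → Binary n →
                                     IsMersenne n ⊎ (∃ λ i → n ≡ 2 * mersenne i) ⊎ BranchingThen2 n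
mersenne⊎2*mersenne⊎branchingThen2 0ᵇ = inj₁ (0 , refl)
mersenne⊎2*mersenne⊎branchingThen2 1+[2 b ] with mersenne⊎hasTwo b
... | inj₁ (i , refl)    = inj₁ (suc i , refl)
... | inj₂ (u , val , r) = inj₂ (inj₂ (u ∷ʳ d1 , value-∷ʳ1 u val , 1<runs-∷ʳ-carry u nonTwo1 r))
mersenne⊎2*mersenne⊎branchingThen2 2[1+ b ] with mersenne⊎hasTwo b
... | inj₁ (i , eq)      = inj₂ (inj₁ (i , cong (2 *_) eq))
... | inj₂ (u , val , r) = inj₂ (inj₂ (u ∷ʳ d0 , value-∷ʳ0 u val , 1<runs-∷ʳ-carry u nonTwo0 r))

treeNumber⊎branching : ∀ {n} → Binary n → TreeNumber n ⊎ Branching n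
treeNumber⊎branching 0ᵇ = inj₁ (powerMinusTwo 0 0)
treeNumber⊎branching 1+[2 b ] with treeNumber⊎branching b
... | inj₁ (power s t)         = inj₁ (power (suc s) t)
... | inj₁ (powerMinusTwo s t) = inj₁ (powerMinusTwo (suc s) t)
... | inj₂ (u , val , r)       =
  inj₂ (u ∷ʳ d1 , value-∷ʳ1 u val , subst (_ <_) (sym (runs-∷ʳ-nonTwo u nonTwo1)) r)
treeNumber⊎branching (2[1+_] {m} _) with mersenne⊎2*mersenne⊎branchingThen2 (binary m)
... | inj₁ (i , refl)          = inj₁ (subst (TreeNumber ∘ (2 *_)) (2^≡suc-mersenne i) (power 0 i))
... | inj₂ (inj₁ (i , refl))   = inj₁ (powerMinusTwo 0 (suc i))
... | inj₂ (inj₂ (u , val , r)) = inj₂ (u ∷ʳ d2 , value-∷ʳ2 u val , r)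

theorem5p5 : (n : ℕ) → 0 < n →
    IsTree n ⇔ ∃ λ s → ∃ λ t →
      (n + 1 ≡ 2 ^ (s + t + 1) + 2 ^ s) ⊎ (n + 2 ^ s + 1 ≡ 2 ^ (s + t + 1))
theorem5p5 n _ = mk⇔ tree⇒form form⇒tree
  where
  form⇒tree : HasTreeForm n → IsTree n
  form⇒tree = acyclic ∘ unbranched⇒atMostOneChild ∘ treeNumber⇒unbranched ∘ form⇒treeNumber

  tree⇒form : IsTree n → HasTreeForm n
  tree⇒form tree with treeNumber⊎branching (binary n)
  ... | inj₁ tn              = treeNumber⇒form tn
  ... | inj₂ (u , val , r)   = ⊥-elim (tree (branching⇒cycle u val r))
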